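{- Let $D=(V,A)$ be an instance of Undirected Reachability Graph Realizability (any of its variants) and $n=|V|$. If $D$ is realizable, then each minimal realization of $D$ assigns at most $n$ labels to each edge.
   Context: An undirected temporal graph is a pair $(G,\lambda)$ with $G=(V,E)$ a simple undirected graph and $\lambda:E\to 2^{\mathbb{N}}$ assigning each edge a finite, possibly empty, set of labels. A strict (resp. non-strict) temporal path from $u$ to $v$ is a sequence $(e_1,t_1),\dots,(e_\ell,t_\ell)$, $t_j\in\lambda(e_j)$, such that $e_1,\dots,e_\ell$ form a $u$-$v$ path and $t_1<\dots<t_\ell$ (resp. $t_1\le\dots\le t_\ell$); the corresponding reachability graph is the digraph on $V$ with arc $(u,v)$, $u\ne v$, iff such a temporal path exists. Undirected Reachability Graph Realizability: given a simple digraph $D=(V,A)$, decide whether some undirected temporal graph on $V$ has (strict or non-strict, depending on the variant) reachability graph equal to $D$, with the labeling possibly required to be simple (one label per labeled edge), proper (no two edges sharing an endpoint share a label) or happy (both). Such a labeling is a realization. A realization $\lambda$ is minimal if for no edge $e$ can $\lambda(e)$ be replaced by a proper subset while still obtaining a realization. -}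

module Defs where

open import Data.Nat using (ℕ; _<_; _≤_)
open import Data.Fin using (Fin)
open import Data.List using (List; []; _∷_; _∷ʳ_; length)
open import Data.List.Membership.Propositional using (_∈_; _∉_)
open import Data.List.Relation.Unary.Unique.Propositional using (Unique)
open import Data.List.Relation.Unary.Linked using (Linked)
open import Data.Product using (Σ; _×_; ∃; ∃-syntax)
open import Data.Sum using (_⊎_)
open import Data.Unit using (⊤)
open import Data.Empty using (⊥)
open import Relation.Nullary using (¬_)
open import Relation.Binary.PropositionalEquality using (_≡_; _≢_)
open import Function.Bundles using (_⇔_)

record Graph (n : ℕ) : Set₁ where
  field
    Adj    : Fin n → Fin n → Set
    adj-sym : ∀ {u v} → Adj u v → Adj v u
    irrefl : ∀ {u} → ¬ Adj u u
open Graph public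

-- The label set of the edge {u,v}
-- is the duplicate-free list  lab u v  (viewed as a set); it does not
-- depend on the orientation of the edge (up to membership) and is empty
-- for non-edges.
record Labeling {n : ℕ} (G : Graph n) : Set where
  field
    lab      : Fin n → Fin n → List ℕ
    lab-uniq : ∀ u v → Unique (lab u v)
    lab-sym  : ∀ u v t → t ∈ lab u v → t ∈ lab v u
    lab-edge : ∀ u v t → t ∈ lab u v → Adj G u v
open Labeling public

data Mode : Set where
  strict nonstrict : Mode

TimeRel : Mode → ℕ → ℕ → Set
TimeRel strict    = _<_
TimeRel nonstrict = _≤_

Steps : {n : ℕ} (G : Graph n) → Labeling G → Fin n → List (Fin n) → List ℕ → Set
Steps G L x []       []       = ⊤
Steps G L x (y ∷ ys) (t ∷ ts) = Adj G x y × t ∈ lab L x y × Steps G L y ys ts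
Steps G L x []       (_ ∷ _)  = ⊥
Steps G L x (_ ∷ _)  []       = ⊥

TemporalPath : {n : ℕ} → Mode → (G : Graph n) → Labeling G → Fin n → Fin n → Set
TemporalPath {n} m G L u v =
  Σ (List (Fin n)) λ ws → Σ (List ℕ) λ ts →
    Unique (u ∷ (ws ∷ʳ v)) × Steps G L u (ws ∷ʳ v) ts × Linked (TimeRel m) ts

data Variant : Set where
  plain simple proper happy : Variant

IsSimple : {n : ℕ} {G : Graph n} → Labeling G → Set
IsSimple L = ∀ u v → length (lab L u v) ≤ 1

IsProper : {n : ℕ} {G : Graph n} → Labeling G → Set
IsProper L = ∀ u v w t → v ≢ w → t ∈ lab L u v → t ∈ lab L u w → ⊥

Satisfies : {n : ℕ} {G : Graph n} → Variant → Labeling G → Set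
Satisfies plain  L = ⊤
Satisfies simple L = IsSimple L
Satisfies proper L = IsProper L
Satisfies happy  L = IsSimple L × IsProper L

Realizes : {n : ℕ} → Mode → (A : Fin n → Fin n → Set) → (G : Graph n) → Labeling G → Set
Realizes m A G L = ∀ u v → u ≢ v → (A u v ⇔ TemporalPath m G L u v)

Realization : {n : ℕ} → Mode → Variant → (A : Fin n → Fin n → Set) → (G : Graph n) → Labeling G → Set
Realization m var A G L = Satisfies var L × Realizes m A G L

SameEdge : {n : ℕ} → Fin n → Fin n → Fin n → Fin n → Set
SameEdge x y u v = (x ≡ u × y ≡ v) ⊎ (x ≡ v × y ≡ u)

_≈ₗ_ : List ℕ → List ℕ → Set
xs ≈ₗ ys = ∀ t → (t ∈ xs ⇔ t ∈ ys)

_⊊ₗ_ : List ℕ → List ℕ → Set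
xs ⊊ₗ ys = (∀ t → t ∈ xs → t ∈ ys) × ∃[ t ] (t ∈ ys × t ∉ xs)

ReplacedByProperSubset : {n : ℕ} {G : Graph n} → Labeling G → Labeling G → Fin n → Fin n → Set
ReplacedByProperSubset L' L u v =
  (∀ x y → ¬ SameEdge x y u v → lab L' x y ≈ₗ lab L x y) × (lab L' u v ⊊ₗ lab L u v)

MinimalRealization : {n : ℕ} → Mode → Variant → (A : Fin n → Fin n → Set) → (G : Graph n) → Labeling G → Set
MinimalRealization m var A G L =
  Realization m var A G L ×
  (∀ u v → Adj G u v → ¬ (Σ (Labeling G) λ L' → ReplacedByProperSubset L' L u v × Realization m var A G L'))

module Submission where

-- For every label t of the edge {u,v}, minimality yields a pair (x,y) with A x y that is no
-- longer reachable once t is deleted, so every temporal x-y path crosses {u,v} at time t.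
-- With more than n labels, two of them, t < t', have such pairs (x,y) and (x,y') with the
-- same source x.  Follow the x-y path up to its crossing at time t and then the x-y' path
-- from its last crossing at time t' on: if both cross {u,v} in the same direction, cross it
-- at time t, otherwise skip it.  This temporal x-y' walk avoids (uv, t'); shortcutting it to
-- a path contradicts the choice of (x,y').  Choosing the pairs needs excluded middle, which
-- is harmless under double negation because the goal is a contradiction.

open import Defs
open import Data.Nat using (ℕ; _≤_; _<_; _≤?_; s≤s)
open import Data.Nat.Properties using (<⇒≤; ≤-trans; <-≤-trans; ≤-<-trans; <⇒≢; <-cmp; ≰⇒>)
import Data.Nat.Properties as ℕ
open import Data.Fin using (Fin; zero; suc)
import Data.Fin as Fin
open import Data.Fin.Properties using (pigeonhole) renaming (_≟_ to _≟ᶠ_)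
open import Data.List using (List; []; _∷_; _∷ʳ_; length; filter; lookup)
open import Data.List.Properties using (length-filter)
open import Data.List.Membership.Propositional using (_∈_)
open import Data.List.Membership.Propositional.Properties using (∈-filter⁺; ∈-filter⁻; ∈-lookup)
open import Data.List.Relation.Unary.Any using (here; there)
open import Data.List.Relation.Unary.All using ([])
import Data.List.Relation.Unary.All as All
open import Data.List.Relation.Unary.All.Properties using (¬Any⇒All¬)
open import Data.List.Relation.Unary.AllPairs using ([]; _∷_)
open import Data.List.Relation.Unary.Unique.Propositional using (Unique)
open import Data.List.Relation.Unary.Unique.Propositional.Properties using (filter⁺)
open import Data.List.Relation.Unary.Linked using (Linked; []; [-]; _∷_)
open import Data.Maybe using (Maybe; just; nothing)
open import Data.Product using (Σ; _×_; _,_; proj₁; proj₂; ∃-syntax)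
open import Data.Sum using (_⊎_; inj₁; inj₂)
open import Data.Unit using (⊤; tt)
open import Data.Empty using (⊥; ⊥-elim)
open import Function using (_∘_)
open import Relation.Nullary using (¬_; Dec; yes; no; ¬?)
open import Relation.Nullary.Decidable using (_×-dec_; _⊎-dec_; ¬¬-excluded-middle)
open import Relation.Binary.PropositionalEquality using (_≡_; _≢_; refl; sym; cong; subst)
open import Relation.Binary.Definitions using (tri<; tri≈; tri>)
open import Function.Bundles using (mk⇔; Equivalence)

¬¬-pull-Fin : ∀ {k} {P : Fin k → Set} → (∀ i → ¬ ¬ P i) → ¬ ¬ (∀ i → P i)
¬¬-pull-Fin {ℕ.zero}  h ¬∀ = ¬∀ λ ()
¬¬-pull-Fin {ℕ.suc k} h ¬∀ =
  h zero λ p₀ → ¬¬-pull-Fin (h ∘ suc) λ ps → ¬∀ λ { zero → p₀ ; (suc i) → ps i }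

lookup-injective : ∀ {xs : List ℕ} → Unique xs →
                   ∀ {i j : Fin (length xs)} → i Fin.< j → lookup xs i ≢ lookup xs j
lookup-injective (x∉xs ∷ _)  {zero}  {suc j} _       = All.lookup x∉xs (∈-lookup j)
lookup-injective (_ ∷ uniq) {suc i} {suc j} (s≤s i<j) = lookup-injective uniq i<j

pigeonhole-ordered : ∀ {n} {xs : List ℕ} → Unique xs → n < length xs → (f : Fin (length xs) → Fin n) →
                     ∃[ i ] ∃[ j ] (lookup xs i < lookup xs j × f i ≡ f j)
pigeonhole-ordered {xs = xs} uniq n<len f with pigeonhole n<len f
... | i , j , i<j , fi≡fj with <-cmp (lookup xs i) (lookup xs j)
...   | tri< lt _ _ = i , j , lt , fi≡fj
...   | tri≈ _ eq _ = ⊥-elim (lookup-injective uniq i<j eq)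
...   | tri> _ _ gt = j , i , gt , sym fi≡fj

TimeRel⇒≤ : ∀ m {s t} → TimeRel m s t → s ≤ t
TimeRel⇒≤ strict    = <⇒≤
TimeRel⇒≤ nonstrict s≤t = s≤t

<⇒TimeRel : ∀ m {s t} → s < t → TimeRel m s t
<⇒TimeRel strict    s<t = s<t
<⇒TimeRel nonstrict = <⇒≤

After : Mode → Maybe ℕ → ℕ → Set
After m nothing  t = ⊤
After m (just s) t = TimeRel m s t

After-≤-trans : ∀ m b {t r} → After m b t → t ≤ r → After m b r
After-≤-trans m         nothing  _   _   = tt
After-≤-trans strict    (just s) s<t t≤r = <-≤-trans s<t t≤r
After-≤-trans nonstrict (just s) s≤t t≤r = ≤-trans s≤t t≤r

After-trans : ∀ m b {t} → After m b t → ∀ r → After m (just t) r → After m b r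
After-trans m b b<t r t<r = After-≤-trans m b b<t (TimeRel⇒≤ m t<r)

TemporalPath-mono : ∀ {n m} {G : Graph n} {L L′ : Labeling G} →
                    (∀ {a b s} → s ∈ lab L a b → s ∈ lab L′ a b) →
                    ∀ {x y} → TemporalPath m G L x y → TemporalPath m G L′ x y
TemporalPath-mono {G = G} {L} {L′} L⊆L′ {x} (ws , ts , uniq , steps , linked) =
  ws , ts , uniq , Steps-mono x (ws ∷ʳ _) ts steps , linked
  where
  Steps-mono : ∀ x vs ts → Steps G L x vs ts → Steps G L′ x vs ts
  Steps-mono x []       []       _                 = tt
  Steps-mono x (y ∷ vs) (t ∷ ts) (xy , t∈ , steps) = xy , L⊆L′ t∈ , Steps-mono y vs ts steps

Satisfies-mono : ∀ {n} {G : Graph n} {L L′ : Labeling G} var →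
                 (∀ {a b s} → s ∈ lab L′ a b → s ∈ lab L a b) →
                 (∀ a b → length (lab L′ a b) ≤ length (lab L a b)) →
                 Satisfies var L → Satisfies var L′
Satisfies-mono plain  ⊆L ≤L _       = tt
Satisfies-mono simple ⊆L ≤L simple′ = λ a b → ≤-trans (≤L a b) (simple′ a b)
Satisfies-mono proper ⊆L ≤L proper′ = λ a b c t b≢c p q → proper′ a b c t b≢c (⊆L p) (⊆L q)
Satisfies-mono {L = L} {L′} happy ⊆L ≤L (simple′ , proper′) =
  Satisfies-mono {L = L} {L′} simple ⊆L ≤L simple′ , Satisfies-mono {L = L} {L′} proper ⊆L ≤L proper′

SameEdge-align : ∀ {n} {a c a′ c′ u v : Fin n} → SameEdge a c u v → SameEdge a′ c′ u v → (c′ ≡ c) ⊎ (c′ ≡ a)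
SameEdge-align (inj₁ (refl , refl)) (inj₁ (refl , refl)) = inj₁ refl
SameEdge-align (inj₁ (refl , refl)) (inj₂ (refl , refl)) = inj₂ refl
SameEdge-align (inj₂ (refl , refl)) (inj₁ (refl , refl)) = inj₂ refl
SameEdge-align (inj₂ (refl , refl)) (inj₂ (refl , refl)) = inj₁ refl

module TemporalWalk {n : ℕ} (m : Mode) (G : Graph n) (L : Labeling G) where
  open import Data.List.Membership.DecPropositional (_≟ᶠ_ {n}) using (_∈?_)

  data Walk : Maybe ℕ → Fin n → Fin n → Set where
    []   : ∀ {b x} → Walk b x x
    step : ∀ {b x y z} t → Adj G x y → t ∈ lab L x y → After m b t → Walk (just t) y z → Walk b x z

  -- Prefix b x a B: a walk from x to a whose continuation must start After B
  -- (B is its last time, or b if it is empty).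
  data Prefix : Maybe ℕ → Fin n → Fin n → Maybe ℕ → Set where
    []   : ∀ {b x} → Prefix b x x b
    step : ∀ {b x y a B} t → Adj G x y → t ∈ lab L x y → After m b t → Prefix (just t) y a B → Prefix b x a B

  vertices : ∀ {b x z} → Walk b x z → List (Fin n)
  vertices []                       = []
  vertices (step {y = y} _ _ _ _ w) = y ∷ vertices w

  times : ∀ {b x z} → Walk b x z → List ℕ
  times []               = []
  times (step t _ _ _ w) = t ∷ times w

  _++ᵖ_ : ∀ {b x a B z} → Prefix b x a B → Walk B a z → Walk b x z
  []                ++ᵖ w = w
  step t xy t∈ bt p ++ᵖ w = step t xy t∈ bt (p ++ᵖ w)

  weaken : ∀ b {b′ x z} → (∀ r → After m b′ r → After m b r) → Walk b′ x z → Walk b x z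
  weaken b f []                  = []
  weaken b f (step t xy t∈ bt w) = step t xy t∈ (f t bt) w

  vertices-weaken : ∀ b {b′ x z} (f : ∀ r → After m b′ r → After m b r) (w : Walk b′ x z) →
                    vertices (weaken b f w) ≡ vertices w
  vertices-weaken b f []               = refl
  vertices-weaken b f (step _ _ _ _ _) = refl

  Prefix-≤ : ∀ {t y a B s} → Prefix (just t) y a B → After m B s → t ≤ s
  Prefix-≤ []                  Bs = TimeRel⇒≤ m Bs
  Prefix-≤ (step _ _ _ tt₁ p) Bs = ≤-trans (TimeRel⇒≤ m tt₁) (Prefix-≤ p Bs)

  dropUntil : ∀ {b a z} x (w : Walk b a z) → x ∈ vertices w → Unique (vertices w) →
              Σ (Walk b x z) λ w′ → Unique (x ∷ vertices w′)
  dropUntil {b} x (step t _ _ bt w) (here refl) uniq =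
    weaken b (After-trans m b bt) w , subst (Unique ∘ (x ∷_)) (sym (vertices-weaken b _ w)) uniq
  dropUntil {b} x (step t _ _ bt w) (there x∈) (_ ∷ uniq) with dropUntil x w x∈ uniq
  ... | w′ , uniq′ =
    weaken b (After-trans m b bt) w′ , subst (Unique ∘ (x ∷_)) (sym (vertices-weaken b _ w′)) uniq′

  shortcut : ∀ {b x z} → Walk b x z → Σ (Walk b x z) λ w′ → Unique (x ∷ vertices w′)
  shortcut []                          = [] , [] ∷ []
  shortcut {b} {x} (step t xy t∈ bt w) with shortcut w
  ... | w′ , uniq with x ∈? vertices (step {b} t xy t∈ bt w′)
  ...   | yes x∈ = dropUntil x (step t xy t∈ bt w′) x∈ uniq
  ...   | no  x∉ = step t xy t∈ bt w′ , ¬Any⇒All¬ _ x∉ ∷ uniq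

  LinkedAfter : Maybe ℕ → List ℕ → Set
  LinkedAfter nothing  ts = Linked (TimeRel m) ts
  LinkedAfter (just s) ts = Linked (TimeRel m) (s ∷ ts)

  LinkedAfter-uncons : ∀ b {t ts} → LinkedAfter b (t ∷ ts) → After m b t × LinkedAfter (just t) ts
  LinkedAfter-uncons nothing  linked        = tt , linked
  LinkedAfter-uncons (just s) (st ∷ linked) = st , linked

  fromSteps : ∀ {b x z} ws ts → Steps G L x (ws ∷ʳ z) ts → LinkedAfter b ts → Walk b x z
  fromSteps {b} []       (t ∷ []) (xz , t∈ , _) linked =
    step t xz t∈ (proj₁ (LinkedAfter-uncons b linked)) []
  fromSteps {b} (_ ∷ ws) (t ∷ ts) (xy , t∈ , steps) linked =
    let bt , linked′ = LinkedAfter-uncons b linked in step t xy t∈ bt (fromSteps ws ts steps linked′)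
  fromSteps []      []          ()
  fromSteps []      (_ ∷ _ ∷ _) (_ , _ , ())
  fromSteps (_ ∷ _) []          ()

  steps : ∀ {b x z} (w : Walk b x z) → Steps G L x (vertices w) (times w)
  steps []                 = tt
  steps (step _ xy t∈ _ w) = xy , t∈ , steps w

  linkedAfter : ∀ {b x z} (w : Walk b x z) → LinkedAfter b (times w)
  linkedAfter {nothing} []                = []
  linkedAfter {just s}  []                = [-]
  linkedAfter {nothing} (step _ _ _ _ w)  = linkedAfter w
  linkedAfter {just s}  (step _ _ _ st w) = st ∷ linkedAfter w

  vertices-∷ʳ : ∀ {b y z} (w : Walk b y z) → ∃[ ws ] (y ∷ vertices w ≡ ws ∷ʳ z)
  vertices-∷ʳ []                       = [] , refl
  vertices-∷ʳ {y = y} (step _ _ _ _ w) with vertices-∷ʳ w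
  ... | ws , eq = y ∷ ws , cong (y ∷_) eq

  toTemporalPath : ∀ {x z} (w : Walk nothing x z) → Unique (x ∷ vertices w) → x ≢ z → TemporalPath m G L x z
  toTemporalPath []                     _    x≢x = ⊥-elim (x≢x refl)
  toTemporalPath {x} w@(step _ _ _ _ w₁) uniq _   with vertices-∷ʳ w₁
  ... | ws , eq = ws , times w , subst (Unique ∘ (x ∷_)) eq uniq ,
                  subst (λ vs → Steps G L x vs (times w)) eq (steps w) , linkedAfter w

  fromTemporalPath : ∀ {x z} → TemporalPath m G L x z → Walk nothing x z
  fromTemporalPath (ws , ts , _ , steps , linked) = fromSteps ws ts steps linked

  walk⇒TemporalPath : ∀ {x z} → Walk nothing x z → x ≢ z → TemporalPath m G L x z
  walk⇒TemporalPath w x≢z = let w′ , uniq = shortcut w in toTemporalPath w′ uniq x≢z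

module RemoveLabel {n : ℕ} (G : Graph n) (L : Labeling G) (u v : Fin n) (r : ℕ) where

  Removed : Fin n → Fin n → ℕ → Set
  Removed a b s = SameEdge a b u v × s ≡ r

  removed? : ∀ a b s → Dec (Removed a b s)
  removed? a b s = (((a ≟ᶠ u) ×-dec (b ≟ᶠ v)) ⊎-dec ((a ≟ᶠ v) ×-dec (b ≟ᶠ u))) ×-dec (s ℕ.≟ r)

  Removed-swap : ∀ {a b s} → Removed a b s → Removed b a s
  Removed-swap (inj₁ (a≡u , b≡v) , s≡r) = inj₂ (b≡v , a≡u) , s≡r
  Removed-swap (inj₂ (a≡v , b≡u) , s≡r) = inj₁ (b≡u , a≡v) , s≡r

  lab⁻ : Fin n → Fin n → List ℕ
  lab⁻ a b = filter (¬? ∘ removed? a b) (lab L a b)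

  ∈-lab⁻⁺ : ∀ {a b s} → s ∈ lab L a b → ¬ Removed a b s → s ∈ lab⁻ a b
  ∈-lab⁻⁺ {a} {b} = ∈-filter⁺ (¬? ∘ removed? a b)

  ∈-lab⁻⁻ : ∀ {a b s} → s ∈ lab⁻ a b → s ∈ lab L a b
  ∈-lab⁻⁻ {a} {b} = proj₁ ∘ ∈-filter⁻ (¬? ∘ removed? a b) {xs = lab L a b}

  ∈-lab⁻⇒¬Removed : ∀ {a b s} → s ∈ lab⁻ a b → ¬ Removed a b s
  ∈-lab⁻⇒¬Removed {a} {b} = proj₂ ∘ ∈-filter⁻ (¬? ∘ removed? a b) {xs = lab L a b}

  L⁻ : Labeling G
  L⁻ = record
    { lab      = lab⁻
    ; lab-uniq = λ a b → filter⁺ (¬? ∘ removed? a b) (lab-uniq L a b)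
    ; lab-sym  = λ a b s s∈ → ∈-lab⁻⁺ (lab-sym L a b s (∈-lab⁻⁻ s∈)) (∈-lab⁻⇒¬Removed s∈ ∘ Removed-swap)
    ; lab-edge = λ a b s s∈ → lab-edge L a b s (∈-lab⁻⁻ s∈)
    }

  L⁻-replaces : r ∈ lab L u v → ReplacedByProperSubset L⁻ L u v
  L⁻-replaces r∈ =
    (λ a b ¬uv s → mk⇔ ∈-lab⁻⁻ λ s∈ → ∈-lab⁻⁺ s∈ (¬uv ∘ proj₁)) ,
    (λ s → ∈-lab⁻⁻) , r , r∈ , λ r∈⁻ → ∈-lab⁻⇒¬Removed r∈⁻ (inj₁ (refl , refl) , refl)

  Satisfies-L⁻ : ∀ var → Satisfies var L → Satisfies var L⁻
  Satisfies-L⁻ var = Satisfies-mono var ∈-lab⁻⁻ λ a b → length-filter (¬? ∘ removed? a b) (lab L a b)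

  module _ (m : Mode) where
    open TemporalWalk m G L
    module W⁻ = TemporalWalk m G L⁻

    record Crossing (b : Maybe ℕ) (x z : Fin n) : Set where
      constructor crossing
      field
        {a c}  : Fin n
        {B}    : Maybe ℕ
        prefix : Prefix b x a B
        on-uv  : SameEdge a c u v
        ac     : Adj G a c
        r∈ac   : r ∈ lab L a c
        Br     : After m B r
        suffix : W⁻.Walk (just r) c z

    avoids-or-crosses : ∀ {b x z} → Walk b x z → W⁻.Walk b x z ⊎ Crossing b x z
    avoids-or-crosses []                                = inj₁ W⁻.[]
    avoids-or-crosses {x = x} (step {y = y} t xy t∈ bt w) with avoids-or-crosses w
    ... | inj₂ (crossing p uv ac r∈ Br w⁻) = inj₂ (crossing (step t xy t∈ bt p) uv ac r∈ Br w⁻)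
    ... | inj₁ w⁻ with removed? x y t
    ...   | yes (uv , refl) = inj₂ (crossing [] uv xy t∈ bt w⁻)
    ...   | no  ¬removed    = inj₁ (W⁻.step t xy (∈-lab⁻⁺ t∈ ¬removed) bt w⁻)

    lost-path-crosses : ∀ {x y} → TemporalPath m G L x y → x ≢ y → ¬ TemporalPath m G L⁻ x y →
                        Crossing nothing x y
    lost-path-crosses path x≢y lost with avoids-or-crosses (fromTemporalPath path)
    ... | inj₁ w⁻      = ⊥-elim (lost (W⁻.walk⇒TemporalPath w⁻ x≢y))
    ... | inj₂ crosses = crosses

    Prefix⁻ : ∀ {b x a B s} → Prefix b x a B → After m B s → s < r → W⁻.Prefix b x a B
    Prefix⁻ []                  _  _   = W⁻.[]
    Prefix⁻ (step t xy t∈ bt p) Bs s<r = W⁻.step t xy (∈-lab⁻⁺ t∈ (t≢r ∘ proj₂)) bt (Prefix⁻ p Bs s<r)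
      where
      t≢r : t ≢ r
      t≢r = <⇒≢ (≤-<-trans (Prefix-≤ p Bs) s<r)

module _ {n} (m : Mode) (G : Graph n) (L : Labeling G) (u v : Fin n) where
  open TemporalWalk m G L using (Prefix)
  open RemoveLabel G L u v using (Crossing; L⁻; ∈-lab⁻⁺; Prefix⁻)
  open Crossing

  crossings-splice : ∀ {t t′ x y y′} → t < t′ → Crossing t m nothing x y → Crossing t′ m nothing x y′ →
                     x ≢ y′ → TemporalPath m G (L⁻ t′) x y′
  crossings-splice {t} {t′} {x} {y′ = y′} t<t′ c c′ = W⁻.walk⇒TemporalPath
    (splice (SameEdge-align (on-uv c) (on-uv c′)) (prefix c) (ac c) (r∈ac c) (Br c) (suffix c′))
    where
    module W⁻ = TemporalWalk m G (L⁻ t′)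

    t<after-t′ : ∀ {s} → TimeRel m t′ s → t < s
    t<after-t′ t′s = <-≤-trans t<t′ (TimeRel⇒≤ m t′s)

    splice : ∀ {a c c′ B} → (c′ ≡ c) ⊎ (c′ ≡ a) → Prefix nothing x a B →
             Adj G a c → t ∈ lab L a c → After m B t → W⁻.Walk (just t′) c′ y′ → W⁻.Walk nothing x y′
    splice (inj₁ refl) p ac t∈ Bt w =
      Prefix⁻ t′ m p Bt t<t′ W⁻.++ᵖ W⁻.step t ac (∈-lab⁻⁺ t′ t∈ (<⇒≢ t<t′ ∘ proj₂)) Bt
                                               (W⁻.weaken (just t) (λ _ → <⇒TimeRel m ∘ t<after-t′) w)
    splice {B = B} (inj₂ refl) p _ _ Bt w =
      Prefix⁻ t′ m p Bt t<t′ W⁻.++ᵖ W⁻.weaken B (λ _ → After-≤-trans m B Bt ∘ <⇒≤ ∘ t<after-t′) w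

module _ (m : Mode) (var : Variant) {n} {A : Fin n → Fin n → Set} {G : Graph n} {L : Labeling G}
         (minimal : MinimalRealization m var A G L) {u v : Fin n} (uv : Adj G u v) where
  open RemoveLabel G L u v using (L⁻; L⁻-replaces; Satisfies-L⁻; ∈-lab⁻⁻; lost-path-crosses)

  satisfies : Satisfies var L
  satisfies = proj₁ (proj₁ minimal)

  realizes : Realizes m A G L
  realizes = proj₂ (proj₁ minimal)

  reaches : ∀ {x y} → x ≢ y → A x y → TemporalPath m G L x y
  reaches x≢y = Equivalence.to (realizes _ _ x≢y)

  LostPair : ℕ → Set
  LostPair t = ∃[ x ] ∃[ y ] (x ≢ y × A x y × ¬ TemporalPath m G (L⁻ t) x y)

  lost-pair : ∀ {t} → t ∈ lab L u v → ¬ ¬ LostPair t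
  lost-pair {t} t∈ noLoss = ¬¬-pull-Fin (λ x → ¬¬-pull-Fin λ y → ¬¬-excluded-middle) λ reach? →
    proj₂ minimal u v uv (L⁻ t , L⁻-replaces t t∈ , Satisfies-L⁻ t var satisfies , realizes⁻ reach?)
    where
    realizes⁻ : (∀ x y → Dec (TemporalPath m G (L⁻ t) x y)) → Realizes m A G (L⁻ t)
    realizes⁻ reach? x y x≢y =
      mk⇔ kept (Equivalence.from (realizes x y x≢y) ∘ TemporalPath-mono {m = m} (∈-lab⁻⁻ t))
      where
      kept : A x y → TemporalPath m G (L⁻ t) x y
      kept Axy with reach? x y
      ... | yes path = path
      ... | no  lost = ⊥-elim (noLoss (x , y , x≢y , Axy , lost))

  lost-sources-distinct : ∀ {t t′} → t < t′ → (p : LostPair t) (p′ : LostPair t′) → proj₁ p ≢ proj₁ p′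
  lost-sources-distinct {t} {t′} t<t′ (x , y , x≢y , Axy , lost) (_ , y′ , x≢y′ , Axy′ , lost′) refl =
    lost′ (crossings-splice m G L u v t<t′ (lost-path-crosses t m (reaches x≢y Axy) x≢y lost)
                                           (lost-path-crosses t′ m (reaches x≢y′ Axy′) x≢y′ lost′) x≢y′)

lemma3 : (m : Mode) (var : Variant) (n : ℕ) (A : Fin n → Fin n → Set) →
         (∀ u → ¬ A u u) →
         (G : Graph n) (L : Labeling G) →
         MinimalRealization m var A G L →
         ∀ u v → Adj G u v → length (lab L u v) ≤ n
lemma3 m var n A _ G L minimal u v uv with length (lab L u v) ≤? n
... | yes ≤n = ≤n
... | no  ≰n = ⊥-elim (¬¬-pull-Fin (λ i → lost-pair m var minimal uv (∈-lookup i)) λ lost →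
  let i , j , lt , same = pigeonhole-ordered (lab-uniq L u v) (≰⇒> ≰n) (proj₁ ∘ lost)
  in  lost-sources-distinct m var minimal uv lt (lost i) (lost j) same)
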